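{- For any context $\Gamma$, type $T$ and basis term $\mathbf b$ (a variable or an abstraction), if $\Gamma\vdash\mathbf b:T$ is derivable in $\lambda^{\mathrm{vec}}_{\mathrm R}$, then there exist unit types $U_1,\dots,U_n$ and scalars $\alpha_1,\dots,\alpha_n$ such that $T\equiv\sum_{i=1}^n\alpha_i\cdot U_i$, $\Gamma\vdash\mathbf b:U_i$ is derivable for each $i\in\{1,\dots,n\}$, and $\sum_{i=1}^n\alpha_i=1$.
   Context: Fix a commutative ring $(\mathsf S,+,\times)$ of scalars. Terms: $\mathbf t ::= x\mid \lambda x.\mathbf t\mid (\mathbf t)\,\mathbf t\mid \alpha\cdot\mathbf t\mid \mathbf t+\mathbf t$, $\alpha\in\mathsf S$; basis terms $\mathbf b::=x\mid\lambda x.\mathbf t$. Types: general $T::=U\mid\alpha\cdot T\mid T+T\mid\mathbb X$, unit $U::=X\mid U\to T\mid\forall X.U\mid\forall\mathbb X.U$ ($X$ unit type variables, $\mathbb X$ general type variables). $\equiv$ is the smallest congruence with $1\cdot T\equiv T$, $\alpha\cdot(\beta\cdot T)\equiv(\alpha\times\beta)\cdot T$, $\alpha\cdot T+\alpha\cdot R\equiv\alpha\cdot(T+R)$, $\alpha\cdot T+\beta\cdot T\equiv(\alpha+\beta)\cdot T$, $T+R\equiv R+T$, $T+(R+S)\equiv(T+R)+S$. In $T[A/X]$, $A$ is unit when $X$ is a unit variable. Contexts are finite sets of $x:U$ with $U$ unit. Typing rules: (ax) $\Gamma,x:U\vdash x:U$; ($\equiv$) from $\Gamma\vdash\mathbf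 t:T$, $R\equiv T$ infer $\Gamma\vdash\mathbf t:R$; ($\to_I$) from $\Gamma,x:U\vdash\mathbf t:T$ infer $\Gamma\vdash\lambda x.\mathbf t:U\to T$; ($\to_E$) from $\Gamma\vdash\mathbf t:\sum_{i=1}^n\alpha_i\cdot\forall\vec X.(U\to T_i)$ and $\Gamma\vdash\mathbf r:\sum_{j=1}^m\beta_j\cdot U[\vec A_j/\vec X]$ infer $\Gamma\vdash(\mathbf t)\,\mathbf r:\sum_{i}\sum_{j}(\alpha_i\times\beta_j)\cdot T_i[\vec A_j/\vec X]$; ($\forall_I$) from $\Gamma\vdash\mathbf t:\sum_i\alpha_i\cdot U_i$, $X\notin FV(\Gamma)$ infer $\Gamma\vdash\mathbf t:\sum_i\alpha_i\cdot\forall X.U_i$; ($\forall_E$) from $\Gamma\vdash\mathbf t:\sum_i\alpha_i\cdot\forall X.U_i$ infer $\Gamma\vdash\mathbf t:\sum_i\alpha_i\cdot U_i[A/X]$; ($+_I$) from $\Gamma\vdash\mathbf t:T$, $\Gamma\vdash\mathbf r:R$ infer $\Gamma\vdash\mathbf t+\mathbf r:T+R$; ($1_E$) from $\Gamma\vdash1\cdot\mathbf t:T$ infer $\Gamma\vdash\mathbf t:T$; ($S$) from $\Gamma\vdash\mathbf t:T_i$ for all $i\in\{1,\dots,n\}$ infer $\Gamma\vdash(\sum_i\alpha_i)\cdot\mathbf t:\sum_i\alpha_i\cdot T_i$. -}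

module Defs where

open import Level using (_⊔_)
open import Data.Nat using (ℕ; zero; suc)
open import Data.Product using (_×_; _,_; proj₁; proj₂)
open import Data.List using (List; []; _∷_)
open import Data.List.NonEmpty as L⁺ using (List⁺; toList; foldr₁; concatMap)
open import Data.List.Relation.Unary.All using (All; []; _∷_)
open import Data.List.Membership.Propositional using (_∈_)
open import Algebra.Bundles using (CommutativeRing)

-- Kinds of type variables: unit type variables X, general type variables 𝕏.
data Kind : Set where
  uK gK : Kind

record Ren : Set where
  constructor ren
  field
    ρu : ℕ → ℕ
    ρg : ℕ → ℕ
open Ren public

extR : (ℕ → ℕ) → ℕ → ℕ
extR ρ zero    = zero
extR ρ (suc i) = suc (ρ i)

liftR : Kind → Ren → Ren
liftR uK (ren u g) = ren (extR u) g
liftR gK (ren u g) = ren u (extR g)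

wk : Kind → Ren
wk uK = ren suc (λ i → i)
wk gK = ren (λ i → i) suc

-- Type variables and term variables are represented by de Bruijn indices; unit
-- and general type variables live in two separate index spaces.
module Vec {c ℓ} (R : CommutativeRing c ℓ) where
  open CommutativeRing R using (_≈_; _+_; _*_; 1#) renaming (Carrier to S)

  infixl 7 _·ₜ_
  infixl 6 _+ₜ_
  data Term : Set c where
    var  : ℕ → Term
    lam  : Term → Term
    app  : Term → Term → Term
    _·ₜ_ : S → Term → Term
    _+ₜ_ : Term → Term → Term

  data IsBasis : Term → Set c where
    var : ∀ x → IsBasis (var x)
    lam : ∀ t → IsBasis (lam t)

  infixr 5 _⇒_
  infixl 7 _·_
  infixl 6 _⊕_
  mutual
    data UType : Set c where
      uvar : ℕ → UType
      _⇒_  : UType → Type → UType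
      all  : Kind → UType → UType      -- ∀X.U (uK) / ∀𝕏.U (gK), binds index 0 of that kind

    data Type : Set c where
      unit : UType → Type
      _·_  : S → Type → Type
      _⊕_  : Type → Type → Type
      gvar : ℕ → Type

  Arg : Kind → Set c
  Arg uK = UType
  Arg gK = Type

  mutual
    renU : Ren → UType → UType
    renU ρ (uvar i)  = uvar (ρu ρ i)
    renU ρ (U ⇒ T)   = renU ρ U ⇒ renT ρ T
    renU ρ (all k U) = all k (renU (liftR k ρ) U)

    renT : Ren → Type → Type
    renT ρ (unit U) = unit (renU ρ U)
    renT ρ (α · T)  = α · renT ρ T
    renT ρ (T ⊕ T') = renT ρ T ⊕ renT ρ T'
    renT ρ (gvar i) = gvar (ρg ρ i)

  record Sub : Set c where
    constructor sub
    field
      σu : ℕ → UType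
      σg : ℕ → Type
  open Sub public

  idS : Sub
  idS = sub uvar gvar

  consU : UType → (ℕ → UType) → ℕ → UType
  consU a σ zero    = a
  consU a σ (suc i) = σ i

  consG : Type → (ℕ → Type) → ℕ → Type
  consG a σ zero    = a
  consG a σ (suc i) = σ i

  extS : (k : Kind) → Arg k → Sub → Sub
  extS uK a (sub u g) = sub (consU a u) g
  extS gK a (sub u g) = sub u (consG a g)

  liftS : Kind → Sub → Sub
  liftS k (sub u g) =
    extS k (var0 k) (sub (λ i → renU (wk k) (u i)) (λ i → renT (wk k) (g i)))
    where
      var0 : (k : Kind) → Arg k
      var0 uK = uvar zero
      var0 gK = gvar zero

  mutual
    subU : Sub → UType → UType
    subU σ (uvar i)  = σu σ i
    subU σ (U ⇒ T)   = subU σ U ⇒ subT σ T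
    subU σ (all k U) = all k (subU (liftS k σ) U)

    subT : Sub → Type → Type
    subT σ (unit U) = unit (subU σ U)
    subT σ (α · T)  = α · subT σ T
    subT σ (T ⊕ T') = subT σ T ⊕ subT σ T'
    subT σ (gvar i) = σg σ i

  _[_/0]U : ∀ {k} → UType → Arg k → UType
  _[_/0]U {k} U A = subU (extS k A idS) U

  -- telescopes  ∀X⃗.U  (list of kinds, outermost binder first)
  ∀⃗ : List Kind → UType → UType
  ∀⃗ []       U = U
  ∀⃗ (k ∷ ks) U = all k (∀⃗ ks U)

  envFrom : Sub → (ks : List Kind) → All Arg ks → Sub
  envFrom σ []       []       = σ
  envFrom σ (k ∷ ks) (a ∷ as) = envFrom (extS k a σ) ks as

  env : (ks : List Kind) → All Arg ks → Sub
  env = envFrom idS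

  wsum : List⁺ (S × Type) → Type
  wsum xs = foldr₁ _⊕_ (L⁺.map (λ p → proj₁ p · proj₂ p) xs)

  usum : List⁺ (S × UType) → Type
  usum xs = wsum (L⁺.map (λ p → proj₁ p , unit (proj₂ p)) xs)

  ssum : ∀ {a} {A : Set a} → List⁺ (S × A) → S
  ssum xs = foldr₁ _+_ (L⁺.map proj₁ xs)

  -- type equivalence ≡ : smallest congruence containing the given axioms
  -- (scalars are compared up to the ring's equality ≈)
  infix 4 _≅_ _≅ᵤ_
  mutual
    data _≅ᵤ_ : UType → UType → Set (c ⊔ ℓ) where
      reflᵤ  : ∀ {U} → U ≅ᵤ U
      symᵤ   : ∀ {U V} → U ≅ᵤ V → V ≅ᵤ U
      transᵤ : ∀ {U V W} → U ≅ᵤ V → V ≅ᵤ W → U ≅ᵤ W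
      ⇒-cong : ∀ {U U' T T'} → U ≅ᵤ U' → T ≅ T' → U ⇒ T ≅ᵤ U' ⇒ T'
      all-cong : ∀ {k U U'} → U ≅ᵤ U' → all k U ≅ᵤ all k U'

    data _≅_ : Type → Type → Set (c ⊔ ℓ) where
      refl≅  : ∀ {T} → T ≅ T
      sym≅   : ∀ {T R} → T ≅ R → R ≅ T
      trans≅ : ∀ {T R Q} → T ≅ R → R ≅ Q → T ≅ Q
      unit-cong : ∀ {U V} → U ≅ᵤ V → unit U ≅ unit V
      ·-cong : ∀ {α β T R} → α ≈ β → T ≅ R → α · T ≅ β · R
      ⊕-cong : ∀ {T T' R R'} → T ≅ T' → R ≅ R' → T ⊕ R ≅ T' ⊕ R'
      one    : ∀ {T} → 1# · T ≅ T
      assoc· : ∀ {α β T} → α · (β · T) ≅ (α * β) · T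
      distr  : ∀ {α T R} → α · T ⊕ α · R ≅ α · (T ⊕ R)
      fact   : ∀ {α β T} → α · T ⊕ β · T ≅ (α + β) · T
      comm⊕  : ∀ {T R} → T ⊕ R ≅ R ⊕ T
      assoc⊕ : ∀ {T R Q} → T ⊕ (R ⊕ Q) ≅ (T ⊕ R) ⊕ Q

  Ctx : Set c
  Ctx = List UType

  data _∋_∶_ : Ctx → ℕ → UType → Set c where
    here  : ∀ {Γ U} → (U ∷ Γ) ∋ zero ∶ U
    there : ∀ {Γ U V x} → Γ ∋ x ∶ U → (V ∷ Γ) ∋ suc x ∶ U

  renCtx : Ren → Ctx → Ctx
  renCtx ρ = Data.List.map (renU ρ)

  mapU : (UType → UType) → List⁺ (S × UType) → List⁺ (S × UType)
  mapU f = L⁺.map (λ p → proj₁ p , f (proj₂ p))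

  infix 3 _⊢_∶_
  data _⊢_∶_ : Ctx → Term → Type → Set (c ⊔ ℓ) where
    ax  : ∀ {Γ x U} → Γ ∋ x ∶ U → Γ ⊢ var x ∶ unit U
    conv : ∀ {Γ t T R} → Γ ⊢ t ∶ T → R ≅ T → Γ ⊢ t ∶ R
    →I  : ∀ {Γ t U T} → (U ∷ Γ) ⊢ t ∶ T → Γ ⊢ lam t ∶ unit (U ⇒ T)
    -- αs = (αᵢ, Tᵢ), βs = (βⱼ, A⃗ⱼ)
    →E  : ∀ {Γ t r} (ks : List Kind) (U : UType)
            (αs : List⁺ (S × Type)) (βs : List⁺ (S × All Arg ks)) →
          Γ ⊢ t ∶ wsum (L⁺.map (λ p → proj₁ p , unit (∀⃗ ks (U ⇒ proj₂ p))) αs) →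
          Γ ⊢ r ∶ usum (L⁺.map (λ q → proj₁ q , subU (env ks (proj₂ q)) U) βs) →
          Γ ⊢ app t r ∶
            wsum (concatMap (λ p → L⁺.map (λ q → proj₁ p * proj₁ q ,
                                              subT (env ks (proj₂ q)) (proj₂ p)) βs) αs)
    ∀I  : ∀ {Γ t} (k : Kind) (Us : List⁺ (S × UType)) →
          renCtx (wk k) Γ ⊢ t ∶ usum Us →
          Γ ⊢ t ∶ usum (mapU (all k) Us)
    ∀E  : ∀ {Γ t} (k : Kind) (A : Arg k) (Us : List⁺ (S × UType)) →
          Γ ⊢ t ∶ usum (mapU (all k) Us) →
          Γ ⊢ t ∶ usum (mapU (λ U → U [ A /0]U) Us)
    +I  : ∀ {Γ t r T R} → Γ ⊢ t ∶ T → Γ ⊢ r ∶ R → Γ ⊢ t +ₜ r ∶ T ⊕ R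
    1E  : ∀ {Γ t T β} → β ≈ 1# → Γ ⊢ β ·ₜ t ∶ T → Γ ⊢ t ∶ T
    S-rule : ∀ {Γ t β} (αs : List⁺ (S × Type)) →
          All (λ p → Γ ⊢ t ∶ proj₂ p) (toList αs) →
          β ≈ ssum αs →
          Γ ⊢ β ·ₜ t ∶ wsum αs

-- Read a type T as a formal combination of unit types and assign it two ≅-invariant
-- quantities: its weight (the sum of its scalars, i.e. the image of T under U ↦ 1) and
-- the property that b has every unit summand of T. Both are preserved by each typing
-- rule that can apply to b, provided we also follow b through the scalar prefixes
-- β₁ · … · βₙ · b that the rules 1E and S strip and add: for such a term the weight is
-- the product of the prefix. Once b : T is known to have weight 1 with all unit
-- summands typable, flattening T gives the required combination.
module Submission where

open import Defs
open import Level using (Level; _⊔_; Lift)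
open import Function using (_∘_; _⇔_; mk⇔; Equivalence)
open import Function.Construct.Identity using (⇔-id)
open import Function.Construct.Symmetry using (⇔-sym)
open import Function.Construct.Composition using (_⇔-∘_)
open import Data.Empty using (⊥)
open import Data.Product using (Σ; _×_; _,_; proj₁; proj₂; swap; assocʳ′; assocˡ′)
open import Data.Product.Function.NonDependent.Propositional using (_×-⇔_)
open import Data.List using (List; []; _∷_)
open import Data.List.NonEmpty using (List⁺; toList; _∷_; _⁺++⁺_)
import Data.List.NonEmpty as List⁺
open import Data.List.Relation.Unary.All as All using (All; []; _∷_; unzip)
open import Data.List.Relation.Unary.All.Properties using (map⁺; map⁻; ++⁺)
open import Algebra.Bundles using (CommutativeRing)

module BasisTyping {c ℓ} (R : CommutativeRing c ℓ) where
  open CommutativeRing R renaming (Carrier to S)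
  open Vec R

  -- A general variable gets the junk weight 1#; it is never a summand of a type of b.
  weight : Type → S
  weight (unit U) = 1#
  weight (α · T)  = α * weight T
  weight (T ⊕ T') = weight T + weight T'
  weight (gvar i) = 1#

  weight-cong : ∀ {T T'} → T ≅ T' → weight T ≈ weight T'
  weight-cong refl≅         = refl
  weight-cong (sym≅ p)      = sym (weight-cong p)
  weight-cong (trans≅ p q)  = trans (weight-cong p) (weight-cong q)
  weight-cong (unit-cong _) = refl
  weight-cong (·-cong α≈β p) = *-cong α≈β (weight-cong p)
  weight-cong (⊕-cong p q)  = +-cong (weight-cong p) (weight-cong q)
  weight-cong one           = *-identityˡ _
  weight-cong assoc·        = sym (*-assoc _ _ _)
  weight-cong distr         = sym (distribˡ _ _ _)
  weight-cong fact          = sym (distribʳ _ _ _)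
  weight-cong comm⊕         = +-comm _ _
  weight-cong assoc⊕        = sym (+-assoc _ _ _)

  SummandsTypable : Ctx → Term → Type → Set (c ⊔ ℓ)
  SummandsTypable Γ b (unit U) = Γ ⊢ b ∶ unit U
  SummandsTypable Γ b (α · T)  = SummandsTypable Γ b T
  SummandsTypable Γ b (T ⊕ T') = SummandsTypable Γ b T × SummandsTypable Γ b T'
  SummandsTypable Γ b (gvar i) = Lift (c ⊔ ℓ) ⊥

  summands-cong : ∀ {Γ b T T'} → T ≅ T' → SummandsTypable Γ b T ⇔ SummandsTypable Γ b T'
  summands-cong refl≅         = ⇔-id _
  summands-cong (sym≅ p)      = ⇔-sym (summands-cong p)
  summands-cong (trans≅ p q)  = summands-cong q ⇔-∘ summands-cong p
  summands-cong (unit-cong p) =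
    mk⇔ (λ d → conv d (unit-cong (symᵤ p))) (λ d → conv d (unit-cong p))
  summands-cong (·-cong _ p)  = summands-cong p
  summands-cong (⊕-cong p q)  = summands-cong p ×-⇔ summands-cong q
  summands-cong one           = ⇔-id _
  summands-cong assoc·        = ⇔-id _
  summands-cong distr         = ⇔-id _
  summands-cong fact          = mk⇔ proj₁ (λ d → d , d)
  summands-cong comm⊕         = mk⇔ swap swap
  summands-cong assoc⊕        = mk⇔ assocˡ′ assocʳ′

  EachTypable : Ctx → Term → List⁺ (S × UType) → Set (c ⊔ ℓ)
  EachTypable Γ b Us = All (λ p → Γ ⊢ b ∶ unit (proj₂ p)) (toList Us)

  summands-usum⁺ : ∀ {Γ b} Us → EachTypable Γ b Us → SummandsTypable Γ b (usum Us)
  summands-usum⁺ (_ ∷ [])     (d ∷ []) = d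
  summands-usum⁺ (_ ∷ u ∷ us) (d ∷ ds) = d , summands-usum⁺ (u ∷ us) ds

  summands-usum⁻ : ∀ {Γ b} u us →
    SummandsTypable Γ b (usum (u ∷ us)) → EachTypable Γ b (u ∷ us)
  summands-usum⁻ _ []       d        = d ∷ []
  summands-usum⁻ _ (u ∷ us) (d , ds) = d ∷ summands-usum⁻ u us ds

  EachTypable-mapU⁺ : ∀ {Γ Δ b} {f g : UType → UType} Us →
    (∀ {U} → Δ ⊢ b ∶ unit (g U) → Γ ⊢ b ∶ unit (f U)) →
    All (λ p → Δ ⊢ b ∶ unit (g (proj₂ p))) (toList Us) → EachTypable Γ b (mapU f Us)
  EachTypable-mapU⁺ (_ ∷ _) h (d ∷ ds) = h d ∷ map⁺ (All.map h ds)

  EachTypable-mapU⁻ : ∀ {Γ b} {f : UType → UType} Us →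
    EachTypable Γ b (mapU f Us) → All (λ p → Γ ⊢ b ∶ unit (f (proj₂ p))) (toList Us)
  EachTypable-mapU⁻ (_ ∷ _) (d ∷ ds) = d ∷ map⁻ ds

  weight-usum-mapU : ∀ (f : UType → UType) u us →
    weight (usum (mapU f (u ∷ us))) ≈ weight (usum (u ∷ us))
  weight-usum-mapU f _ []       = refl
  weight-usum-mapU f _ (u ∷ us) = +-cong refl (weight-usum-mapU f u us)

  summands-wsum⁺ : ∀ {Γ b} αs →
    All (SummandsTypable Γ b ∘ proj₂) (toList αs) → SummandsTypable Γ b (wsum αs)
  summands-wsum⁺ (_ ∷ [])     (d ∷ []) = d
  summands-wsum⁺ (_ ∷ a ∷ as) (d ∷ ds) = d , summands-wsum⁺ (a ∷ as) ds

  weight-wsum : ∀ {k} αs →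
    All (λ p → weight (proj₂ p) ≈ k) (toList αs) → weight (wsum αs) ≈ ssum αs * k
  weight-wsum (_ ∷ [])     (e ∷ []) = *-cong refl e
  weight-wsum (_ ∷ a ∷ as) (e ∷ es) =
    trans (+-cong (*-cong refl e) (weight-wsum (a ∷ as) es)) (sym (distribʳ _ _ _))

  ∀I-unit : ∀ {Γ t U} k → renCtx (wk k) Γ ⊢ t ∶ unit U → Γ ⊢ t ∶ unit (all k U)
  ∀I-unit k d = conv (∀I k ((1# , _) ∷ []) (conv d one)) (sym≅ one)

  ∀E-unit : ∀ {Γ t U} k (A : Arg k) → Γ ⊢ t ∶ unit (all k U) → Γ ⊢ t ∶ unit (U [ A /0]U)
  ∀E-unit k A d = conv (∀E k A ((1# , _) ∷ []) (conv d one)) (sym≅ one)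

  data Scaled (b : Term) : Term → S → Set c where
    unscaled : Scaled b b 1#
    scale    : ∀ {t k} γ → Scaled b t k → Scaled b (γ ·ₜ t) (γ * k)

  mutual
    scaled-basis-typing : ∀ {Γ b t T k} → IsBasis b → Scaled b t k → Γ ⊢ t ∶ T →
      SummandsTypable Γ b T × weight T ≈ k
    scaled-basis-typing _ unscaled (ax x) = ax x , refl
    scaled-basis-typing _ unscaled (→I d) = →I d , refl
    scaled-basis-typing basis s (conv d p) =
      let summands , w≈k = scaled-basis-typing basis s d
      in Equivalence.from (summands-cong p) summands , trans (weight-cong p) w≈k
    scaled-basis-typing basis s (∀I k Us@(u ∷ us) d) =
      let summands , w≈k = scaled-basis-typing basis s d
      in summands-usum⁺ (mapU (all k) Us)
           (EachTypable-mapU⁺ Us (∀I-unit k) (summands-usum⁻ u us summands))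
       , trans (weight-usum-mapU (all k) u us) w≈k
    scaled-basis-typing basis s (∀E k A Us@(u ∷ us) d) =
      let summands , w≈k = scaled-basis-typing basis s d
      in summands-usum⁺ (mapU (_[ A /0]U) Us)
           (EachTypable-mapU⁺ Us (∀E-unit k A)
             (EachTypable-mapU⁻ Us (summands-usum⁻ _ _ summands)))
       , trans (weight-usum-mapU _ u us) (trans (sym (weight-usum-mapU (all k) u us)) w≈k)
    scaled-basis-typing basis s (1E β≈1 d) =
      let summands , w≈βk = scaled-basis-typing basis (scale _ s) d
      in summands , trans w≈βk (trans (*-cong β≈1 refl) (*-identityˡ _))
    scaled-basis-typing basis (scale γ s) (S-rule αs ds γ≈Σα) =
      let summands , weights = unzip (scaled-basis-typing-all basis s ds)
      in summands-wsum⁺ αs summands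
       , trans (weight-wsum αs weights) (*-cong (sym γ≈Σα) refl)
    scaled-basis-typing () unscaled (→E _ _ _ _ _ _)
    scaled-basis-typing () unscaled (+I _ _)
    scaled-basis-typing () unscaled (S-rule _ _ _)

    scaled-basis-typing-all : ∀ {Γ b t k} {αs : List (S × Type)} → IsBasis b → Scaled b t k →
      All (λ p → Γ ⊢ t ∶ proj₂ p) αs →
      All (λ p → SummandsTypable Γ b (proj₂ p) × weight (proj₂ p) ≈ k) αs
    scaled-basis-typing-all basis s []       = []
    scaled-basis-typing-all basis s (d ∷ ds) =
      scaled-basis-typing basis s d ∷ scaled-basis-typing-all basis s ds

  scaleU : S → List⁺ (S × UType) → List⁺ (S × UType)
  scaleU α = List⁺.map (λ p → α * proj₁ p , proj₂ p)

  ·-usum : ∀ α u us → α · usum (u ∷ us) ≅ usum (scaleU α (u ∷ us))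
  ·-usum α _ []       = assoc·
  ·-usum α _ (u ∷ us) = trans≅ (sym≅ distr) (⊕-cong assoc· (·-usum α u us))

  ssum-scaleU : ∀ α u us → ssum (scaleU α (u ∷ us)) ≈ α * ssum (u ∷ us)
  ssum-scaleU α _ []       = refl
  ssum-scaleU α _ (u ∷ us) = trans (+-cong refl (ssum-scaleU α u us)) (sym (distribˡ _ _ _))

  EachTypable-scaleU : ∀ {Γ b} α Us → EachTypable Γ b Us → EachTypable Γ b (scaleU α Us)
  EachTypable-scaleU α (_ ∷ _) (d ∷ ds) = d ∷ map⁺ ds

  usum-⁺++⁺ : ∀ u us Vs → usum ((u ∷ us) ⁺++⁺ Vs) ≅ usum (u ∷ us) ⊕ usum Vs
  usum-⁺++⁺ _ []       _ = refl≅
  usum-⁺++⁺ _ (u ∷ us) Vs = trans≅ (⊕-cong refl≅ (usum-⁺++⁺ u us Vs)) assoc⊕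

  ssum-⁺++⁺ : ∀ u us (Vs : List⁺ (S × UType)) →
    ssum ((u ∷ us) ⁺++⁺ Vs) ≈ ssum (u ∷ us) + ssum Vs
  ssum-⁺++⁺ _ []       _ = refl
  ssum-⁺++⁺ _ (u ∷ us) Vs = trans (+-cong refl (ssum-⁺++⁺ u us Vs)) (sym (+-assoc _ _ _))

  EachTypable-⁺++⁺ : ∀ {Γ b} Us Vs → EachTypable Γ b Us → EachTypable Γ b Vs →
    EachTypable Γ b (Us ⁺++⁺ Vs)
  EachTypable-⁺++⁺ (_ ∷ _) (_ ∷ _) (d ∷ ds) es = d ∷ ++⁺ ds es

  decompose : ∀ {Γ b} T → SummandsTypable Γ b T →
    Σ (List⁺ (S × UType)) λ Us → (T ≅ usum Us) × EachTypable Γ b Us × ssum Us ≈ weight T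
  decompose (unit U) d = (1# , U) ∷ [] , sym≅ one , d ∷ [] , refl
  decompose (α · T) d =
    let u ∷ us , T≅ , typable , ssum≈ = decompose T d
    in scaleU α (u ∷ us) , trans≅ (·-cong refl T≅) (·-usum α u us)
     , EachTypable-scaleU α (u ∷ us) typable , trans (ssum-scaleU α u us) (*-cong refl ssum≈)
  decompose (T ⊕ T') (d , d') =
    let u ∷ us , T≅ , typable , ssum≈ = decompose T d
        Vs , T'≅ , typable' , ssum≈' = decompose T' d'
    in (u ∷ us) ⁺++⁺ Vs , trans≅ (⊕-cong T≅ T'≅) (sym≅ (usum-⁺++⁺ u us Vs))
     , EachTypable-⁺++⁺ (u ∷ us) Vs typable typable'
     , trans (ssum-⁺++⁺ u us Vs) (+-cong ssum≈ ssum≈')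

mainTheorem8 : ∀ {c ℓ : Level} (R : CommutativeRing c ℓ) →
    let open Vec R in ∀ (Γ : Ctx) (T : Type) (b : Term) → IsBasis b → Γ ⊢ b ∶ T →
       Σ (List⁺ (CommutativeRing.Carrier R × UType)) λ Us →
         (T ≅ usum Us) × All (λ p → Γ ⊢ b ∶ unit (proj₂ p)) (toList Us) × CommutativeRing._≈_ R (ssum Us) (CommutativeRing.1# R)
mainTheorem8 R Γ T b basis ⊢b =
  let open BasisTyping R
      summands , weight≈1 = scaled-basis-typing basis unscaled ⊢b
      Us , T≅ , typable , ssum≈weight = decompose T summands
  in Us , T≅ , typable , CommutativeRing.trans R ssum≈weight weight≈1
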